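{- Let $T$ be a monad on $\mathbf{Set}$, $\mathcal{D}$ a complete category, and $\bar\Omega=(\Omega_{\mathcal{D}},\tau)$ a $\mathcal{D}$-relative $T$-algebra (so $\tau\colon T\to\mathcal{D}(\Omega_{\mathcal{D}}^{(-)},\Omega_{\mathcal{D}})$ is a monad map). Define: (i) $[-,\bar\Omega]_{\mathcal{D}}\colon\mathcal{D}^{\mathrm{op}}\to\mathcal{E}\mathcal{M}(T)$ sending $D$ to the set $\mathcal{D}(D,\Omega_{\mathcal{D}})$ with $T$-algebra structure $\zeta_D=(\mathrm{id}^\sharp)^*\circ\tau_{\mathcal{D}(D,\Omega_{\mathcal{D}})}\colon T(\mathcal{D}(D,\Omega_{\mathcal{D}}))\to\mathcal{D}(\Omega_{\mathcal{D}}^{\mathcal{D}(D,\Omega_{\mathcal{D}})},\Omega_{\mathcal{D}})\to\mathcal{D}(D,\Omega_{\mathcal{D}})$, where $\mathrm{id}^\sharp=\langle k\rangle_{k\in\mathcal{D}(D,\Omega_{\mathcal{D}})}\colon D\to\Omega_{\mathcal{D}}^{\mathcal{D}(D,\Omega_{\mathcal{D}})}$ and $(\mathrm{id}^\sharp)^*$ is precomposition with it; a morphism $k\colon D\to E$ is sent to precomposition $k^*\colon\mathcal{D}(E,\Omega_{\mathcal{D}})\to\mathcal{D}(D,\Omega_{\mathcal{D}})$. (ii) $[-,\bar\Omega]_T\colon\mathcal{E}\mathcal{M}(T)\to\mathcal{D}^{\mathrm{op}}$ sending a $T$-algebra $(A,a\colon TA\to A)$ to the equalizer in $\mathcal{D}$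 of $a^*,\tau^\sharp_A\colon\Omega_{\mathcal{D}}^A\rightrightarrows\Omega_{\mathcal{D}}^{TA}$, and a $T$-algebra morphism $f\colon(A,a)\to(B,b)$ to the morphism between equalizers induced by $f^*\colon\Omega_{\mathcal{D}}^B\to\Omega_{\mathcal{D}}^A$. (iii) $\mathbb{P}^\tau\colon\mathcal{K}\ell(T)\to\mathcal{D}^{\mathrm{op}}$ sending $X$ to $\Omega_{\mathcal{D}}^X$ and a Kleisli arrow $f\colon X\to TY$ to $f^*\circ\tau^\sharp_Y\colon\Omega_{\mathcal{D}}^Y\to\Omega_{\mathcal{D}}^{TY}\to\Omega_{\mathcal{D}}^X$. Then these are well-defined functors, $[-,\bar\Omega]_T$ is left adjoint to $[-,\bar\Omega]_{\mathcal{D}}$, and $\mathbb{P}^\tau\cong[-,\bar\Omega]_T\circ K$, where $K\colon\mathcal{K}\ell(T)\to\mathcal{E}\mathcal{M}(T)$ is the comparison functor $X\mapsto(TX,\mu_X)$, $f\mapsto\mu_Y\circ Tf$.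
   Context: For $A\in\mathcal{D}$ and a set $X$, $A^X$ is the $X$-fold product with projections $\pi_x$; for a function $g\colon X\to Y$, $g^*\colon A^Y\to A^X$ is the morphism with $\pi_x\circ g^*=\pi_{g(x)}$. The monad $\mathcal{D}(A^{(-)},A)$ on $\mathbf{Set}$: on $g\colon X\to Y$ it sends $k$ to $k\circ g^*$; unit $\eta_X(x)=\pi_x$; multiplication $\mu_X(\Xi)=\Xi\circ\langle\varphi\rangle_{\varphi\in\mathcal{D}(A^X,A)}$. A $\mathcal{D}$-relative $T$-algebra is a pair $(A,\alpha)$ with $\alpha\colon T\to\mathcal{D}(A^{(-)},A)$ a monad map (natural transformation compatible with units and multiplications). For such, $\alpha^\sharp_X=\langle\alpha_X(t)\rangle_{t\in TX}\colon A^X\to A^{TX}$. $\mathcal{E}\mathcal{M}(T)$ and $\mathcal{K}\ell(T)$ are the Eilenberg–Moore and Kleisli categories of $T$. -}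

module Defs where

open import Level using (Level; _⊔_; 0ℓ) renaming (suc to lsuc)
open import Relation.Binary.PropositionalEquality
open import Relation.Binary.Structures using (IsEquivalence)
open import Data.Product using (Σ; _,_; proj₁; proj₂; _×_)

record Category (o ℓ e : Level) : Set (lsuc (o ⊔ ℓ ⊔ e)) where
  infix 4 _≈_
  infixr 9 _∘_
  field
    Obj : Set o
    _⇒_ : Obj → Obj → Set ℓ
    _≈_ : ∀ {A B} → A ⇒ B → A ⇒ B → Set e
    id : ∀ {A} → A ⇒ A
    _∘_ : ∀ {A B C} → B ⇒ C → A ⇒ B → A ⇒ C
    ≈-equiv : ∀ {A B} → IsEquivalence (_≈_ {A} {B})
    ∘-resp-≈ : ∀ {A B C} {f h : B ⇒ C} {g i : A ⇒ B} → f ≈ h → g ≈ i → (f ∘ g) ≈ (h ∘ i)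
    identityˡ : ∀ {A B} {f : A ⇒ B} → (id ∘ f) ≈ f
    identityʳ : ∀ {A B} {f : A ⇒ B} → (f ∘ id) ≈ f
    assoc : ∀ {A B C D} {f : A ⇒ B} {g : B ⇒ C} {h : C ⇒ D} →
            ((h ∘ g) ∘ f) ≈ (h ∘ (g ∘ f))

op : ∀ {o ℓ e} → Category o ℓ e → Category o ℓ e
op C = record
  { Obj = Obj
  ; _⇒_ = λ A B → B ⇒ A
  ; _≈_ = _≈_
  ; id = id
  ; _∘_ = λ f g → g ∘ f
  ; ≈-equiv = ≈-equiv
  ; ∘-resp-≈ = λ p q → ∘-resp-≈ q p
  ; identityˡ = identityʳ
  ; identityʳ = identityˡ
  ; assoc = IsEquivalence.sym ≈-equiv assoc
  }
  where open Category C

record RawFunctor {o ℓ e o' ℓ' e' : Level} (C : Category o ℓ e) (D : Category o' ℓ' e')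
       : Set (o ⊔ ℓ ⊔ o' ⊔ ℓ') where
  field
    F₀ : Category.Obj C → Category.Obj D
    F₁ : ∀ {A B} → Category._⇒_ C A B → Category._⇒_ D (F₀ A) (F₀ B)

_∘F_ : ∀ {o ℓ e o' ℓ' e' o'' ℓ'' e''} {C : Category o ℓ e} {D : Category o' ℓ' e'}
         {E : Category o'' ℓ'' e''} → RawFunctor D E → RawFunctor C D → RawFunctor C E
G ∘F F = record { F₀ = λ X → RawFunctor.F₀ G (RawFunctor.F₀ F X)
                ; F₁ = λ f → RawFunctor.F₁ G (RawFunctor.F₁ F f) }

module _ {o ℓ e o' ℓ' e' : Level} {C : Category o ℓ e} {D : Category o' ℓ' e'} where
  private
    module C = Category C
    module D = Category D

  record IsFunctor (F : RawFunctor C D) : Set (o ⊔ ℓ ⊔ e ⊔ e') where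
    open RawFunctor F
    field
      F-resp-≈ : ∀ {A B} {f g : A C.⇒ B} → f C.≈ g → F₁ f D.≈ F₁ g
      F-id : ∀ {A} → F₁ (C.id {A}) D.≈ D.id
      F-∘ : ∀ {A B X} (f : A C.⇒ B) (g : B C.⇒ X) → F₁ (g C.∘ f) D.≈ (F₁ g D.∘ F₁ f)

  record NatIso (F G : RawFunctor C D) : Set (o ⊔ ℓ ⊔ ℓ' ⊔ e') where
    private
      module F = RawFunctor F
      module G = RawFunctor G
    field
      η : ∀ X → F.F₀ X D.⇒ G.F₀ X
      η⁻¹ : ∀ X → G.F₀ X D.⇒ F.F₀ X
      iso-l : ∀ X → (η⁻¹ X D.∘ η X) D.≈ D.id
      iso-r : ∀ X → (η X D.∘ η⁻¹ X) D.≈ D.id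
      natural : ∀ {X Y} (f : X C.⇒ Y) → (η Y D.∘ F.F₁ f) D.≈ (G.F₁ f D.∘ η X)

  record Adjunction (L : RawFunctor C D) (R : RawFunctor D C)
         : Set (o ⊔ ℓ ⊔ e ⊔ o' ⊔ ℓ' ⊔ e') where
    private
      module L = RawFunctor L
      module R = RawFunctor R
    field
      unit : ∀ X → X C.⇒ R.F₀ (L.F₀ X)
      counit : ∀ Y → L.F₀ (R.F₀ Y) D.⇒ Y
      unit-natural : ∀ {X X'} (f : X C.⇒ X') →
                     (R.F₁ (L.F₁ f) C.∘ unit X) C.≈ (unit X' C.∘ f)
      counit-natural : ∀ {Y Y'} (g : Y D.⇒ Y') →
                       (g D.∘ counit Y) D.≈ (counit Y' D.∘ L.F₁ (R.F₁ g))
      zig : ∀ X → (counit (L.F₀ X) D.∘ L.F₁ (unit X)) D.≈ D.id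
      zag : ∀ Y → (R.F₁ (counit Y) C.∘ unit (R.F₀ Y)) C.≈ C.id

record StrictCat (o : Level) : Set (lsuc o) where
  infixr 9 _∘_
  field
    Obj : Set o
    Hom : Obj → Obj → Set
    id : ∀ {A} → Hom A A
    _∘_ : ∀ {A B C} → Hom B C → Hom A B → Hom A C
    identityˡ : ∀ {A B} {f : Hom A B} → id ∘ f ≡ f
    identityʳ : ∀ {A B} {f : Hom A B} → f ∘ id ≡ f
    assoc : ∀ {A B C D} {f : Hom A B} {g : Hom B C} {h : Hom C D} →
            (h ∘ g) ∘ f ≡ h ∘ (g ∘ f)

toCategory : ∀ {o} → StrictCat o → Category o 0ℓ 0ℓ
toCategory D = record
  { Obj = Obj ; _⇒_ = Hom ; _≈_ = _≡_ ; id = id ; _∘_ = _∘_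
  ; ≈-equiv = isEquivalence
  ; ∘-resp-≈ = cong₂ _∘_
  ; identityˡ = identityˡ ; identityʳ = identityʳ ; assoc = assoc }
  where open StrictCat D

module _ {o : Level} (D : StrictCat o) where
  open StrictCat D

  record Product (X : Set) (F : X → Obj) : Set o where
    field
      ΠF : Obj
      π : (x : X) → Hom ΠF (F x)
      ⟨_⟩ : ∀ {B} → ((x : X) → Hom B (F x)) → Hom B ΠF
      π-⟨⟩ : ∀ {B} (h : (x : X) → Hom B (F x)) (x : X) → π x ∘ ⟨ h ⟩ ≡ h x
      ⟨⟩-unique : ∀ {B} (h : (x : X) → Hom B (F x)) (k : Hom B ΠF) →
                  ((x : X) → π x ∘ k ≡ h x) → k ≡ ⟨ h ⟩

  record Equalizer {A B : Obj} (f g : Hom A B) : Set o where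
    field
      Eq : Obj
      e : Hom Eq A
      equalizes : f ∘ e ≡ g ∘ e
      factor : ∀ {C} (h : Hom C A) → f ∘ h ≡ g ∘ h → Hom C Eq
      e-factor : ∀ {C} (h : Hom C A) (p : f ∘ h ≡ g ∘ h) → e ∘ factor h p ≡ h
      factor-unique : ∀ {C} (h : Hom C A) (p : f ∘ h ≡ g ∘ h) (k : Hom C Eq) →
                      e ∘ k ≡ h → k ≡ factor h p

  record Complete : Set (lsuc 0ℓ ⊔ o) where
    field
      products : (X : Set) (F : X → Obj) → Product X F
      equalizers : ∀ {A B} (f g : Hom A B) → Equalizer f g

record Monad : Set₁ where
  field
    T : Set → Set
    fmap : ∀ {X Y} → (X → Y) → T X → T Y
    η : ∀ {X} → X → T X
    μ : ∀ {X} → T (T X) → T X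
    fmap-cong : ∀ {X Y} {f g : X → Y} → (∀ x → f x ≡ g x) → ∀ t → fmap f t ≡ fmap g t
    fmap-id : ∀ {X} (t : T X) → fmap (λ x → x) t ≡ t
    fmap-∘ : ∀ {X Y Z} (f : X → Y) (g : Y → Z) (t : T X) →
             fmap (λ x → g (f x)) t ≡ fmap g (fmap f t)
    η-natural : ∀ {X Y} (f : X → Y) (x : X) → fmap f (η x) ≡ η (f x)
    μ-natural : ∀ {X Y} (f : X → Y) (t : T (T X)) → fmap f (μ t) ≡ μ (fmap (fmap f) t)
    μ-η : ∀ {X} (t : T X) → μ (η t) ≡ t
    μ-Tη : ∀ {X} (t : T X) → μ (fmap η t) ≡ t
    μ-assoc : ∀ {X} (t : T (T (T X))) → μ (μ t) ≡ μ (fmap μ t)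

module MonadCats (M : Monad) where
  open Monad M

  record IsAlgebra {A : Set} (a : T A → A) : Set where
    field
      unit-law : ∀ x → a (η x) ≡ x
      assoc-law : ∀ t → a (μ t) ≡ a (fmap a t)

  record Algebra : Set₁ where
    field
      Carrier : Set
      act : T Carrier → Carrier
      isAlgebra : IsAlgebra act
  open Algebra public

  IsAlgHom : {A B : Set} (a : T A → A) (b : T B → B) (f : A → B) → Set
  IsAlgHom a b f = ∀ t → f (a t) ≡ b (fmap f t)

  record AlgHom (A B : Algebra) : Set where
    field
      fun : Carrier A → Carrier B
      isHom : IsAlgHom (act A) (act B) fun
  open AlgHom public

  EM : Category (lsuc 0ℓ) 0ℓ 0ℓ
  EM = record
    { Obj = Algebra
    ; _⇒_ = AlgHom
    ; _≈_ = λ f g → ∀ x → fun f x ≡ fun g x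
    ; id = λ {A} → record { fun = λ x → x ; isHom = λ t → sym (cong (act A) (fmap-id t)) }
    ; _∘_ = λ {A} {B} {C} g f → record
        { fun = λ x → fun g (fun f x)
        ; isHom = λ t → trans (cong (fun g) (isHom f t))
                        (trans (isHom g (fmap (fun f) t))
                               (cong (act C) (sym (fmap-∘ (fun f) (fun g) t)))) }
    ; ≈-equiv = record { refl = λ x → refl ; sym = λ p x → sym (p x)
                       ; trans = λ p q x → trans (p x) (q x) }
    ; ∘-resp-≈ = λ {_} {_} {_} {f} {h} {g} {i} p q x → trans (cong (fun f) (q x)) (p (fun i x))
    ; identityˡ = λ x → refl
    ; identityʳ = λ x → refl
    ; assoc = λ x → refl
    }

  kcomp : ∀ {X Y Z : Set} → (Y → T Z) → (X → T Y) → X → T Z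
  kcomp g f x = μ (fmap g (f x))

  Kl : Category (lsuc 0ℓ) 0ℓ 0ℓ
  Kl = record
    { Obj = Set
    ; _⇒_ = λ X Y → X → T Y
    ; _≈_ = λ f g → ∀ x → f x ≡ g x
    ; id = η
    ; _∘_ = kcomp
    ; ≈-equiv = record { refl = λ x → refl ; sym = λ p x → sym (p x)
                       ; trans = λ p q x → trans (p x) (q x) }
    ; ∘-resp-≈ = λ {_} {_} {_} {f} {h} {g} {i} p q x →
        trans (cong (λ s → μ (fmap f s)) (q x)) (cong μ (fmap-cong p (i x)))
    ; identityˡ = λ {_} {_} {f} x → μ-Tη (f x)
    ; identityʳ = λ {_} {_} {f} x → trans (cong μ (η-natural f x)) (μ-η (f x))
    ; assoc = λ {_} {_} {_} {_} {f} {g} {h} x → sym (assocK f g h x)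
    }
    where
    assocK : ∀ {A B C D : Set} (f : A → T B) (g : B → T C) (h : C → T D) (x : A) →
             μ (fmap h (μ (fmap g (f x)))) ≡ μ (fmap (λ y → μ (fmap h (g y))) (f x))
    assocK f g h x =
      trans (cong μ (μ-natural h (fmap g (f x))))
      (trans (μ-assoc (fmap (fmap h) (fmap g (f x))))
      (cong μ (trans (sym (fmap-∘ (fmap h) μ (fmap g (f x))))
                     (sym (fmap-∘ g (λ s → μ (fmap h s)) (f x))))))

  freeAlg : Set → Algebra
  freeAlg X = record
    { Carrier = T X ; act = μ
    ; isAlgebra = record { unit-law = μ-η ; assoc-law = μ-assoc } }

  K : RawFunctor Kl EM
  K = record
    { F₀ = freeAlg
    ; F₁ = λ f → record
        { fun = λ s → μ (fmap f s)
        ; isHom = λ t → trans (cong μ (μ-natural f t))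
                  (trans (μ-assoc (fmap (fmap f) t))
                         (cong μ (sym (fmap-∘ (fmap f) μ t)))) } }

module Constructions {o : Level} (M : Monad) (D : StrictCat o) (cpl : Complete D) where
  open Monad M
  open StrictCat D
  open Complete cpl

  pow : Obj → Set → Obj
  pow A X = Product.ΠF (products X (λ _ → A))

  proj : (A : Obj) {X : Set} (x : X) → Hom (pow A X) A
  proj A {X} = Product.π (products X (λ _ → A))

  tuple : (A : Obj) {X : Set} {B : Obj} → (X → Hom B A) → Hom B (pow A X)
  tuple A {X} = Product.⟨_⟩ (products X (λ _ → A))

  pull : (A : Obj) {X Y : Set} → (X → Y) → Hom (pow A Y) (pow A X)
  pull A g = tuple A (λ x → proj A (g x))

  record RelAlg (A : Obj) : Set (lsuc 0ℓ ⊔ o) where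
    field
      α : ∀ {X : Set} → T X → Hom (pow A X) A
      α-natural : ∀ {X Y : Set} (g : X → Y) (t : T X) → α (fmap g t) ≡ α t ∘ pull A g
      α-unit : ∀ {X : Set} (x : X) → α (η x) ≡ proj A x
      α-mult : ∀ {X : Set} (t : T (T X)) →
               α (μ t) ≡ α (fmap (α {X}) t) ∘ tuple A (λ (φ : Hom (pow A X) A) → φ)

  sharp : {A : Obj} → RelAlg A → (X : Set) → Hom (pow A X) (pow A (T X))
  sharp {A} r X = tuple A (λ t → RelAlg.α r t)

module Theory {o : Level} (M : Monad) (D : StrictCat o) (cpl : Complete D)
              (Ω : StrictCat.Obj D) (τ : Constructions.RelAlg M D cpl Ω) where
  open Monad M
  open StrictCat D
  open Complete cpl
  open Constructions M D cpl
  open MonadCats M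
  open RelAlg τ

  Dop : Category o 0ℓ 0ℓ
  Dop = op (toCategory D)

  idSharp : (E : Obj) → Hom E (pow Ω (Hom E Ω))
  idSharp E = tuple Ω (λ k → k)

  ζ : (E : Obj) → T (Hom E Ω) → Hom E Ω
  ζ E t = α t ∘ idSharp E

  -- well-definedness of [-,Ω̄]_D on objects: ζ_E is an EM algebra
  ZetaAlgebras : Set o
  ZetaAlgebras = (E : Obj) → IsAlgebra (ζ E)

  -- well-definedness of [-,Ω̄]_D on morphisms: k* is an algebra morphism
  PrecompHoms : Set o
  PrecompHoms = ∀ {E E' : Obj} (k : Hom E' E) → IsAlgHom (ζ E) (ζ E') (λ l → l ∘ k)

  RD : ZetaAlgebras → PrecompHoms → RawFunctor Dop EM
  RD za kh = record
    { F₀ = λ E → record { Carrier = Hom E Ω ; act = ζ E ; isAlgebra = za E }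
    ; F₁ = λ k → record { fun = λ l → l ∘ k ; isHom = kh k } }

  τ♯ : (X : Set) → Hom (pow Ω X) (pow Ω (T X))
  τ♯ = sharp τ

  eqz : (A : Algebra) → Equalizer D (pull Ω (act A)) (τ♯ (Carrier A))
  eqz A = equalizers (pull Ω (act A)) (τ♯ (Carrier A))

  eqObj : Algebra → Obj
  eqObj A = Equalizer.Eq (eqz A)

  eqMap : (A : Algebra) → Hom (eqObj A) (pow Ω (Carrier A))
  eqMap A = Equalizer.e (eqz A)

  -- well-definedness of [-,Ω̄]_T on morphisms: f* ∘ e_B equalizes a*, τ♯_A
  InducedEqualizes : Set₁
  InducedEqualizes = ∀ {A B : Algebra} (f : AlgHom A B) →
    pull Ω (act A) ∘ (pull Ω (fun f) ∘ eqMap B)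
      ≡ τ♯ (Carrier A) ∘ (pull Ω (fun f) ∘ eqMap B)

  LT : InducedEqualizes → RawFunctor EM Dop
  LT ie = record
    { F₀ = eqObj
    ; F₁ = λ {A} {B} f → Equalizer.factor (eqz A) (pull Ω (fun f) ∘ eqMap B) (ie f) }

  Pτ : RawFunctor Kl Dop
  Pτ = record
    { F₀ = λ X → pow Ω X
    ; F₁ = λ {X} {Y} f → pull Ω f ∘ τ♯ Y }

module Submission where

-- Proof of Theorem 4.8.  Everything reduces to a small calculus of tuples in
-- the powers A^X of D:  reindexing a tuple (pull-tuple), precomposing a tuple
-- (tuple-∘) and the η-rule  ⟨π_x ∘ k⟩_x = k  (tuple-proj).
--   * For an arbitrary D-relative T-algebra (A, α) the monad-map axioms are
--     recast as laws for α♯ : A^X → A^{TX}: naturality, the unit law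
--     η* ∘ α♯ = id, the multiplication law μ* ∘ α♯ = α♯ ∘ α♯, and hence the
--     Kleisli law, which is exactly functoriality of ℙ^τ.
--   * ζ_E is an algebra and k* an algebra map, because τ♯ ∘ id♯ = ⟨ζ_E⟩ and
--     reindexing commutes with tuples.
--   * [-,Ω̄]_T is defined via equalizers; all its laws follow from the fact
--     that the equalizer map is monic.  The unit of the adjunction sends a ∈ A
--     to π_a ∘ e_A, the counit is the factorisation of id♯ through the
--     equalizer of ζ*, τ♯.
--   * For a free algebra (TX, μ_X), τ♯_X factors through the equalizer and is
--     inverse to η* ∘ e; this gives ℙ^τ ≅ [-,Ω̄]_T ∘ K.

open import Level using (Level)
open import Data.Product using (Σ; _×_; _,_)
open import Relation.Binary.PropositionalEquality
open import Defs

module PowerLaws {o : Level} (M : Monad) (D : StrictCat o) (cpl : Complete D) where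
  open StrictCat D
  open Complete cpl
  open Constructions M D cpl

  private
    module P {A : Obj} {X : Set} = Product (products X (λ _ → A))

  proj-tuple : ∀ {A : Obj} {X : Set} {B : Obj} (h : X → Hom B A) (x : X) →
               proj A x ∘ tuple A h ≡ h x
  proj-tuple = P.π-⟨⟩

  tuple-proj : ∀ {A : Obj} {X : Set} {B : Obj} (k : Hom B (pow A X)) →
               tuple A (λ x → proj A x ∘ k) ≡ k
  tuple-proj k = sym (P.⟨⟩-unique _ k (λ x → refl))

  tuple-cong : ∀ {A : Obj} {X : Set} {B : Obj} {h h' : X → Hom B A} →
               (∀ x → h x ≡ h' x) → tuple A h ≡ tuple A h'
  tuple-cong {h = h} p = P.⟨⟩-unique _ (tuple _ h) (λ x → trans (proj-tuple h x) (p x))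

  tuple-∘ : ∀ {A : Obj} {X : Set} {B C : Obj} (h : X → Hom B A) (k : Hom C B) →
            tuple A h ∘ k ≡ tuple A (λ x → h x ∘ k)
  tuple-∘ h k = P.⟨⟩-unique _ (tuple _ h ∘ k)
    (λ x → trans (sym assoc) (cong (_∘ k) (proj-tuple h x)))

  pull-tuple : ∀ {A : Obj} {X Y : Set} {B : Obj} (g : X → Y) (h : Y → Hom B A) →
               pull A g ∘ tuple A h ≡ tuple A (λ x → h (g x))
  pull-tuple {A} g h = P.⟨⟩-unique _ (pull A g ∘ tuple A h) (λ x → begin
    proj A x ∘ (pull A g ∘ tuple A h) ≡⟨ sym assoc ⟩
    (proj A x ∘ pull A g) ∘ tuple A h ≡⟨ cong (_∘ tuple A h) (proj-tuple _ x) ⟩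
    proj A (g x) ∘ tuple A h          ≡⟨ proj-tuple h (g x) ⟩
    h (g x)                           ∎)
    where open ≡-Reasoning

  pull-id : ∀ {A : Obj} {X : Set} → pull A (λ (x : X) → x) ≡ id
  pull-id {A} = trans (tuple-cong (λ x → sym identityʳ)) (tuple-proj id)

  pull-∘ : ∀ {A : Obj} {X Y Z : Set} (g : X → Y) (h : Y → Z) →
           pull A g ∘ pull A h ≡ pull A (λ x → h (g x))
  pull-∘ {A} g h = pull-tuple g (λ y → proj A (h y))

  pull-cong : ∀ {A : Obj} {X Y : Set} {g h : X → Y} → (∀ x → g x ≡ h x) → pull A g ≡ pull A h
  pull-cong {A} p = tuple-cong (λ x → cong (proj A) (p x))

module EqualizerLaws {o : Level} (D : StrictCat o) where
  open StrictCat D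

  e-monic : ∀ {A B : Obj} {f g : Hom A B} (E : Equalizer D f g) {C : Obj}
              {k k' : Hom C (Equalizer.Eq E)} →
            Equalizer.e E ∘ k ≡ Equalizer.e E ∘ k' → k ≡ k'
  e-monic {f = f} {g} E {k = k} {k'} q =
    trans (factor-unique (e ∘ k') e∘k'-equalizes k q) (sym (factor-unique (e ∘ k') e∘k'-equalizes k' refl))
    where
    open Equalizer E
    e∘k'-equalizes : f ∘ (e ∘ k') ≡ g ∘ (e ∘ k')
    e∘k'-equalizes = trans (sym assoc) (trans (cong (_∘ k') equalizes) assoc)

module RelativeAlgebraLaws {o : Level} (M : Monad) (D : StrictCat o) (cpl : Complete D)
                           {A : StrictCat.Obj D} (r : Constructions.RelAlg M D cpl A) where
  open Monad M
  open StrictCat D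
  open Constructions M D cpl
  open MonadCats M using (kcomp)
  open RelAlg r
  open PowerLaws M D cpl
  open ≡-Reasoning

  α♯ : (X : Set) → Hom (pow A X) (pow A (T X))
  α♯ = sharp r

  α-fmap-tuple : ∀ {X Y : Set} {B : Obj} (g : X → Y) (t : T X) (h : Y → Hom B A) →
                 α (fmap g t) ∘ tuple A h ≡ α t ∘ tuple A (λ x → h (g x))
  α-fmap-tuple g t h = begin
    α (fmap g t) ∘ tuple A h      ≡⟨ cong (_∘ tuple A h) (α-natural g t) ⟩
    (α t ∘ pull A g) ∘ tuple A h  ≡⟨ assoc ⟩
    α t ∘ (pull A g ∘ tuple A h)  ≡⟨ cong (α t ∘_) (pull-tuple g h) ⟩
    α t ∘ tuple A (λ x → h (g x)) ∎

  α-μ : ∀ {X : Set} (t : T (T X)) → α (μ t) ≡ α t ∘ α♯ X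
  α-μ t = trans (α-mult t) (α-fmap-tuple α t (λ φ → φ))

  α-bind : ∀ {Y Z : Set} (g : Y → T Z) (s : T Y) → α (μ (fmap g s)) ≡ α s ∘ (pull A g ∘ α♯ Z)
  α-bind {Z = Z} g s = begin
    α (μ (fmap g s))          ≡⟨ α-μ (fmap g s) ⟩
    α (fmap g s) ∘ α♯ Z       ≡⟨ cong (_∘ α♯ Z) (α-natural g s) ⟩
    (α s ∘ pull A g) ∘ α♯ Z   ≡⟨ assoc ⟩
    α s ∘ (pull A g ∘ α♯ Z)   ∎

  sharp-natural : ∀ {X Y : Set} (f : X → Y) → pull A (fmap f) ∘ α♯ Y ≡ α♯ X ∘ pull A f
  sharp-natural {X} {Y} f = begin
    pull A (fmap f) ∘ α♯ Y              ≡⟨ pull-tuple (fmap f) α ⟩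
    tuple A (λ t → α (fmap f t))        ≡⟨ tuple-cong (α-natural f) ⟩
    tuple A (λ t → α t ∘ pull A f)      ≡⟨ sym (tuple-∘ α (pull A f)) ⟩
    α♯ X ∘ pull A f                     ∎

  sharp-unit : ∀ {X : Set} → pull A η ∘ α♯ X ≡ id
  sharp-unit {X} = begin
    pull A η ∘ α♯ X            ≡⟨ pull-tuple η α ⟩
    tuple A (λ x → α (η x))    ≡⟨ tuple-cong α-unit ⟩
    pull A (λ x → x)           ≡⟨ pull-id ⟩
    id                         ∎

  sharp-mult : ∀ {X : Set} → pull A μ ∘ α♯ X ≡ α♯ (T X) ∘ α♯ X
  sharp-mult {X} = begin
    pull A μ ∘ α♯ X              ≡⟨ pull-tuple μ α ⟩
    tuple A (λ t → α (μ t))      ≡⟨ tuple-cong α-μ ⟩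
    tuple A (λ t → α t ∘ α♯ X)   ≡⟨ sym (tuple-∘ α (α♯ X)) ⟩
    α♯ (T X) ∘ α♯ X              ∎

  sharp-kleisli : ∀ {X Y Z : Set} (f : X → T Y) (g : Y → T Z) →
                  pull A (kcomp g f) ∘ α♯ Z ≡ (pull A f ∘ α♯ Y) ∘ (pull A g ∘ α♯ Z)
  sharp-kleisli {Y = Y} {Z} f g = begin
    pull A (kcomp g f) ∘ α♯ Z                        ≡⟨ pull-tuple (kcomp g f) α ⟩
    tuple A (λ x → α (μ (fmap g (f x))))             ≡⟨ tuple-cong (λ x → α-bind g (f x)) ⟩
    tuple A (λ x → α (f x) ∘ (pull A g ∘ α♯ Z))      ≡⟨ sym (tuple-∘ (λ x → α (f x)) _) ⟩
    tuple A (λ x → α (f x)) ∘ (pull A g ∘ α♯ Z)      ≡⟨ cong (_∘ (pull A g ∘ α♯ Z)) (sym (pull-tuple f α)) ⟩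
    (pull A f ∘ α♯ Y) ∘ (pull A g ∘ α♯ Z)            ∎

module Theorem {o : Level} (M : Monad) (D : StrictCat o) (cpl : Complete D)
               (Ω : StrictCat.Obj D) (τ : Constructions.RelAlg M D cpl Ω) where
  open Monad M
  open StrictCat D
  open Constructions M D cpl
  open MonadCats M
  open RelAlg τ
  open Theory M D cpl Ω τ
  open PowerLaws M D cpl
  open EqualizerLaws D
  open RelativeAlgebraLaws M D cpl τ
    using (α-fmap-tuple; α-μ; sharp-natural; sharp-unit; sharp-mult; sharp-kleisli)
  open ≡-Reasoning

  τ♯-idSharp : (E : Obj) → τ♯ (Hom E Ω) ∘ idSharp E ≡ tuple Ω (ζ E)
  τ♯-idSharp E = tuple-∘ α (idSharp E)

  idSharp-natural : ∀ {E E' : Obj} (k : Hom E' E) →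
                    idSharp E ∘ k ≡ pull Ω (_∘ k) ∘ idSharp E'
  idSharp-natural k = trans (tuple-∘ (λ l → l) k) (sym (pull-tuple (_∘ k) (λ l → l)))

  ζ-algebras : ZetaAlgebras
  ζ-algebras E = record { unit-law = unit-law ; assoc-law = assoc-law }
    where
    unit-law : ∀ k → ζ E (η k) ≡ k
    unit-law k = trans (cong (_∘ idSharp E) (α-unit k)) (proj-tuple (λ l → l) k)
    assoc-law : ∀ t → ζ E (μ t) ≡ ζ E (fmap (ζ E) t)
    assoc-law t = begin
      α (μ t) ∘ idSharp E                  ≡⟨ cong (_∘ idSharp E) (α-μ t) ⟩
      (α t ∘ τ♯ (Hom E Ω)) ∘ idSharp E     ≡⟨ assoc ⟩
      α t ∘ (τ♯ (Hom E Ω) ∘ idSharp E)     ≡⟨ cong (α t ∘_) (τ♯-idSharp E) ⟩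
      α t ∘ tuple Ω (ζ E)                  ≡⟨ sym (α-fmap-tuple (ζ E) t (λ l → l)) ⟩
      α (fmap (ζ E) t) ∘ idSharp E         ∎

  precomposition-homs : PrecompHoms
  precomposition-homs {E} {E'} k t = begin
    (α t ∘ idSharp E) ∘ k                    ≡⟨ assoc ⟩
    α t ∘ (idSharp E ∘ k)                    ≡⟨ cong (α t ∘_) (tuple-∘ (λ l → l) k) ⟩
    α t ∘ tuple Ω (_∘ k)                     ≡⟨ sym (α-fmap-tuple (_∘ k) t (λ l → l)) ⟩
    α (fmap (_∘ k) t) ∘ idSharp E'           ∎

  pull-algHom : ∀ {A B : Algebra} (f : AlgHom A B) →
                pull Ω (act A) ∘ pull Ω (fun f) ≡ pull Ω (fmap (fun f)) ∘ pull Ω (act B)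
  pull-algHom f = trans (pull-∘ _ (fun f))
                  (trans (pull-cong (isHom f)) (sym (pull-∘ (fmap (fun f)) _)))

  induced-equalizes : InducedEqualizes
  induced-equalizes {A} {B} f = begin
    pull Ω (act A) ∘ (pull Ω (fun f) ∘ eqMap B)          ≡⟨ sym assoc ⟩
    (pull Ω (act A) ∘ pull Ω (fun f)) ∘ eqMap B          ≡⟨ cong (_∘ eqMap B) (pull-algHom f) ⟩
    (pull Ω (fmap (fun f)) ∘ pull Ω (act B)) ∘ eqMap B   ≡⟨ assoc ⟩
    pull Ω (fmap (fun f)) ∘ (pull Ω (act B) ∘ eqMap B)   ≡⟨ cong (pull Ω (fmap (fun f)) ∘_) (Equalizer.equalizes (eqz B)) ⟩
    pull Ω (fmap (fun f)) ∘ (τ♯ (Carrier B) ∘ eqMap B)   ≡⟨ sym assoc ⟩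
    (pull Ω (fmap (fun f)) ∘ τ♯ (Carrier B)) ∘ eqMap B   ≡⟨ cong (_∘ eqMap B) (sharp-natural (fun f)) ⟩
    (τ♯ (Carrier A) ∘ pull Ω (fun f)) ∘ eqMap B          ≡⟨ assoc ⟩
    τ♯ (Carrier A) ∘ (pull Ω (fun f) ∘ eqMap B)          ∎

  RD' : RawFunctor Dop EM
  RD' = RD ζ-algebras precomposition-homs

  LT' : RawFunctor EM Dop
  LT' = LT induced-equalizes

  LT₁ : ∀ {A B : Algebra} → AlgHom A B → Hom (eqObj B) (eqObj A)
  LT₁ = RawFunctor.F₁ LT'

  e-LT₁ : ∀ {A B : Algebra} (f : AlgHom A B) → eqMap A ∘ LT₁ f ≡ pull Ω (fun f) ∘ eqMap B
  e-LT₁ {A} {B} f = Equalizer.e-factor (eqz A) (pull Ω (fun f) ∘ eqMap B) (induced-equalizes f)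

  RD-functor : IsFunctor RD'
  RD-functor = record
    { F-resp-≈ = λ p l → cong (l ∘_) p
    ; F-id = λ l → identityʳ
    ; F-∘ = λ f g l → sym assoc }

  LT-functor : IsFunctor LT'
  LT-functor = record
    { F-resp-≈ = λ {A} {B} {f} {g} p → e-monic (eqz A) (begin
        eqMap A ∘ LT₁ f           ≡⟨ e-LT₁ f ⟩
        pull Ω (fun f) ∘ eqMap B  ≡⟨ cong (_∘ eqMap B) (pull-cong p) ⟩
        pull Ω (fun g) ∘ eqMap B  ≡⟨ sym (e-LT₁ g) ⟩
        eqMap A ∘ LT₁ g           ∎)
    ; F-id = λ {A} → e-monic (eqz A) (begin
        eqMap A ∘ LT₁ (Category.id EM {A})  ≡⟨ e-LT₁ (Category.id EM {A}) ⟩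
        pull Ω (λ x → x) ∘ eqMap A          ≡⟨ cong (_∘ eqMap A) pull-id ⟩
        id ∘ eqMap A                        ≡⟨ identityˡ ⟩
        eqMap A                             ≡⟨ sym identityʳ ⟩
        eqMap A ∘ id                        ∎)
    ; F-∘ = λ {A} {B} {C} f g → e-monic (eqz A) (begin
        eqMap A ∘ LT₁ (Category._∘_ EM g f)          ≡⟨ e-LT₁ (Category._∘_ EM g f) ⟩
        pull Ω (λ x → fun g (fun f x)) ∘ eqMap C     ≡⟨ cong (_∘ eqMap C) (sym (pull-∘ (fun f) (fun g))) ⟩
        (pull Ω (fun f) ∘ pull Ω (fun g)) ∘ eqMap C  ≡⟨ assoc ⟩
        pull Ω (fun f) ∘ (pull Ω (fun g) ∘ eqMap C)  ≡⟨ cong (pull Ω (fun f) ∘_) (sym (e-LT₁ g)) ⟩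
        pull Ω (fun f) ∘ (eqMap B ∘ LT₁ g)           ≡⟨ sym assoc ⟩
        (pull Ω (fun f) ∘ eqMap B) ∘ LT₁ g           ≡⟨ cong (_∘ LT₁ g) (sym (e-LT₁ f)) ⟩
        (eqMap A ∘ LT₁ f) ∘ LT₁ g                    ≡⟨ assoc ⟩
        eqMap A ∘ (LT₁ f ∘ LT₁ g)                    ∎) }

  Pτ-functor : IsFunctor Pτ
  Pτ-functor = record
    { F-resp-≈ = λ {X} {Y} p → cong (_∘ τ♯ Y) (pull-cong p)
    ; F-id = sharp-unit
    ; F-∘ = sharp-kleisli }

  unit-fun : (A : Algebra) → Carrier A → Hom (eqObj A) Ω
  unit-fun A a = proj Ω a ∘ eqMap A

  unit-tuple : (A : Algebra) → pull Ω (unit-fun A) ∘ idSharp (eqObj A) ≡ eqMap A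
  unit-tuple A = trans (pull-tuple (unit-fun A) (λ l → l)) (tuple-proj (eqMap A))

  unit-hom : (A : Algebra) → AlgHom A (RawFunctor.F₀ RD' (eqObj A))
  unit-hom A = record { fun = unit-fun A ; isHom = λ t → begin
    proj Ω (act A t) ∘ eqMap A                      ≡⟨ cong (_∘ eqMap A) (sym (proj-tuple _ t)) ⟩
    (proj Ω t ∘ pull Ω (act A)) ∘ eqMap A           ≡⟨ assoc ⟩
    proj Ω t ∘ (pull Ω (act A) ∘ eqMap A)           ≡⟨ cong (proj Ω t ∘_) (Equalizer.equalizes (eqz A)) ⟩
    proj Ω t ∘ (τ♯ (Carrier A) ∘ eqMap A)           ≡⟨ sym assoc ⟩
    (proj Ω t ∘ τ♯ (Carrier A)) ∘ eqMap A           ≡⟨ cong (_∘ eqMap A) (proj-tuple α t) ⟩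
    α t ∘ eqMap A                                   ≡⟨ cong (α t ∘_) (sym (tuple-proj (eqMap A))) ⟩
    α t ∘ tuple Ω (unit-fun A)                      ≡⟨ sym (α-fmap-tuple (unit-fun A) t (λ l → l)) ⟩
    α (fmap (unit-fun A) t) ∘ idSharp (eqObj A)     ∎ }

  RA : Obj → Algebra
  RA = RawFunctor.F₀ RD'

  idSharp-equalizes : (Y : Obj) → pull Ω (ζ Y) ∘ idSharp Y ≡ τ♯ (Hom Y Ω) ∘ idSharp Y
  idSharp-equalizes Y = trans (pull-tuple (ζ Y) (λ l → l)) (sym (τ♯-idSharp Y))

  counit : (Y : Obj) → Hom Y (eqObj (RA Y))
  counit Y = Equalizer.factor (eqz (RA Y)) (idSharp Y) (idSharp-equalizes Y)

  e-counit : (Y : Obj) → eqMap (RA Y) ∘ counit Y ≡ idSharp Y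
  e-counit Y = Equalizer.e-factor (eqz (RA Y)) (idSharp Y) (idSharp-equalizes Y)

  adjunction : Adjunction LT' RD'
  adjunction = record
    { unit = unit-hom
    ; counit = counit
    ; unit-natural = λ {A} {B} f a → begin
        (proj Ω a ∘ eqMap A) ∘ LT₁ f           ≡⟨ assoc ⟩
        proj Ω a ∘ (eqMap A ∘ LT₁ f)           ≡⟨ cong (proj Ω a ∘_) (e-LT₁ f) ⟩
        proj Ω a ∘ (pull Ω (fun f) ∘ eqMap B)  ≡⟨ sym assoc ⟩
        (proj Ω a ∘ pull Ω (fun f)) ∘ eqMap B  ≡⟨ cong (_∘ eqMap B) (proj-tuple _ a) ⟩
        proj Ω (fun f a) ∘ eqMap B             ∎
    ; counit-natural = λ {Y} {Y'} g → e-monic (eqz (RA Y)) (begin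
        eqMap (RA Y) ∘ (counit Y ∘ g)                      ≡⟨ sym assoc ⟩
        (eqMap (RA Y) ∘ counit Y) ∘ g                      ≡⟨ cong (_∘ g) (e-counit Y) ⟩
        idSharp Y ∘ g                                      ≡⟨ idSharp-natural g ⟩
        pull Ω (_∘ g) ∘ idSharp Y'                         ≡⟨ cong (pull Ω (_∘ g) ∘_) (sym (e-counit Y')) ⟩
        pull Ω (_∘ g) ∘ (eqMap (RA Y') ∘ counit Y')        ≡⟨ sym assoc ⟩
        (pull Ω (_∘ g) ∘ eqMap (RA Y')) ∘ counit Y'        ≡⟨ cong (_∘ counit Y') (sym (e-LT₁ (RawFunctor.F₁ RD' g))) ⟩
        (eqMap (RA Y) ∘ LT₁ (RawFunctor.F₁ RD' g)) ∘ counit Y' ≡⟨ assoc ⟩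
        eqMap (RA Y) ∘ (LT₁ (RawFunctor.F₁ RD' g) ∘ counit Y') ∎)
    ; zig = λ A → e-monic (eqz A) (begin
        eqMap A ∘ (LT₁ (unit-hom A) ∘ counit (eqObj A))                ≡⟨ sym assoc ⟩
        (eqMap A ∘ LT₁ (unit-hom A)) ∘ counit (eqObj A)                ≡⟨ cong (_∘ counit (eqObj A)) (e-LT₁ (unit-hom A)) ⟩
        (pull Ω (unit-fun A) ∘ eqMap (RA (eqObj A))) ∘ counit (eqObj A) ≡⟨ assoc ⟩
        pull Ω (unit-fun A) ∘ (eqMap (RA (eqObj A)) ∘ counit (eqObj A)) ≡⟨ cong (pull Ω (unit-fun A) ∘_) (e-counit (eqObj A)) ⟩
        pull Ω (unit-fun A) ∘ idSharp (eqObj A)                         ≡⟨ unit-tuple A ⟩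
        eqMap A                                                        ≡⟨ sym identityʳ ⟩
        eqMap A ∘ id                                                   ∎)
    ; zag = λ Y l → begin
        (proj Ω l ∘ eqMap (RA Y)) ∘ counit Y  ≡⟨ assoc ⟩
        proj Ω l ∘ (eqMap (RA Y) ∘ counit Y)  ≡⟨ cong (proj Ω l ∘_) (e-counit Y) ⟩
        proj Ω l ∘ idSharp Y                  ≡⟨ proj-tuple (λ k → k) l ⟩
        l                                     ∎
    }

  eF : (X : Set) → Hom (eqObj (freeAlg X)) (pow Ω (T X))
  eF X = eqMap (freeAlg X)

  toPower : (X : Set) → Hom (eqObj (freeAlg X)) (pow Ω X)
  toPower X = pull Ω η ∘ eF X

  fromPower : (X : Set) → Hom (pow Ω X) (eqObj (freeAlg X))
  fromPower X = Equalizer.factor (eqz (freeAlg X)) (τ♯ X) sharp-mult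

  e-fromPower : (X : Set) → eF X ∘ fromPower X ≡ τ♯ X
  e-fromPower X = Equalizer.e-factor (eqz (freeAlg X)) (τ♯ X) sharp-mult

  -- on the equalizer of μ*, τ♯_{TX}, τ♯_X undoes η*:  τ♯ ∘ η* ∘ e = (Tη)* ∘ μ* ∘ e = e
  τ♯-toPower : (X : Set) → τ♯ X ∘ toPower X ≡ eF X
  τ♯-toPower X = begin
    τ♯ X ∘ (pull Ω η ∘ eF X)                       ≡⟨ sym assoc ⟩
    (τ♯ X ∘ pull Ω η) ∘ eF X                       ≡⟨ cong (_∘ eF X) (sym (sharp-natural η)) ⟩
    (pull Ω (fmap η) ∘ τ♯ (T X)) ∘ eF X            ≡⟨ assoc ⟩
    pull Ω (fmap η) ∘ (τ♯ (T X) ∘ eF X)            ≡⟨ cong (pull Ω (fmap η) ∘_) (sym (Equalizer.equalizes (eqz (freeAlg X)))) ⟩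
    pull Ω (fmap η) ∘ (pull Ω μ ∘ eF X)            ≡⟨ sym assoc ⟩
    (pull Ω (fmap η) ∘ pull Ω μ) ∘ eF X            ≡⟨ cong (_∘ eF X) (pull-∘ (fmap η) μ) ⟩
    pull Ω (λ t → μ (fmap η t)) ∘ eF X             ≡⟨ cong (_∘ eF X) (trans (pull-cong μ-Tη) pull-id) ⟩
    id ∘ eF X                                      ≡⟨ identityˡ ⟩
    eF X                                           ∎

  η*-K : ∀ {X Y : Set} (f : X → T Y) →
         pull Ω η ∘ pull Ω (λ s → μ (fmap f s)) ≡ pull Ω f
  η*-K f = trans (pull-∘ η _) (pull-cong (λ x → trans (cong μ (η-natural f x)) (μ-η (f x))))

  Pτ≅LT∘K : NatIso Pτ (LT' ∘F K)
  Pτ≅LT∘K = record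
    { η = toPower
    ; η⁻¹ = fromPower
    ; iso-l = λ X → begin
        (pull Ω η ∘ eF X) ∘ fromPower X  ≡⟨ assoc ⟩
        pull Ω η ∘ (eF X ∘ fromPower X)  ≡⟨ cong (pull Ω η ∘_) (e-fromPower X) ⟩
        pull Ω η ∘ τ♯ X                  ≡⟨ sharp-unit ⟩
        id                               ∎
    ; iso-r = λ X → e-monic (eqz (freeAlg X)) (begin
        eF X ∘ (fromPower X ∘ toPower X)  ≡⟨ sym assoc ⟩
        (eF X ∘ fromPower X) ∘ toPower X  ≡⟨ cong (_∘ toPower X) (e-fromPower X) ⟩
        τ♯ X ∘ toPower X                  ≡⟨ τ♯-toPower X ⟩
        eF X                              ≡⟨ sym identityʳ ⟩
        eF X ∘ id                         ∎)
    ; natural = λ {X} {Y} f → begin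
        (pull Ω f ∘ τ♯ Y) ∘ toPower Y                       ≡⟨ assoc ⟩
        pull Ω f ∘ (τ♯ Y ∘ toPower Y)                       ≡⟨ cong (pull Ω f ∘_) (τ♯-toPower Y) ⟩
        pull Ω f ∘ eF Y                                     ≡⟨ cong (_∘ eF Y) (sym (η*-K f)) ⟩
        (pull Ω η ∘ pull Ω (λ s → μ (fmap f s))) ∘ eF Y     ≡⟨ assoc ⟩
        pull Ω η ∘ (pull Ω (λ s → μ (fmap f s)) ∘ eF Y)     ≡⟨ cong (pull Ω η ∘_) (sym (e-LT₁ (RawFunctor.F₁ K f))) ⟩
        pull Ω η ∘ (eF X ∘ LT₁ (RawFunctor.F₁ K f))         ≡⟨ sym assoc ⟩
        toPower X ∘ LT₁ (RawFunctor.F₁ K f)                 ∎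
    }

theorem4p8 : ∀ {o : Level} (M : Monad) (D : StrictCat o) (cpl : Complete D)
    (Ω : StrictCat.Obj D) (τ : Constructions.RelAlg M D cpl Ω) →
    let open Theory M D cpl Ω τ in
    let open MonadCats M using (K) in
    Σ ZetaAlgebras (λ za → Σ PrecompHoms (λ kh → Σ InducedEqualizes (λ ie →
    IsFunctor (RD za kh) × IsFunctor (LT ie) × IsFunctor Pτ
    × Adjunction (LT ie) (RD za kh)
    × NatIso Pτ (LT ie ∘F K))))
theorem4p8 M D cpl Ω τ =
    ζ-algebras , precomposition-homs , induced-equalizes
  , RD-functor , LT-functor , Pτ-functor
  , adjunction , Pτ≅LT∘K
  where open Theorem M D cpl Ω τ
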